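{- Let $d\ge 1$ be an integer and let $G$ be a finite, connected, $d$-regular simple graph that is not complete. Then \[\min_{v,r}\delta(\mathcal{L}_r(v))\leq\left\lfloor 2d/3\right\rfloor-1,\] where the minimum is over all vertices $v$ of $G$ and all integers $r\ge 1$ with $\mathcal{S}_r(v)\neq\varnothing$. Moreover, for every $d\equiv 2\pmod 3$ there exists a finite, connected, non-complete $d$-regular graph for which equality holds.
   Context: For a graph $G$, a vertex $v$ and an integer $r>0$, the sphere $\mathcal{S}_r(v)=\{w\in V(G): d(v,w)=r\}$ is the set of vertices at graph distance exactly $r$ from $v$. If $\mathcal{S}_r(v)\neq\varnothing$, the $r$-link graph of $v$ is the induced subgraph $\mathcal{L}_r(v)=G[\mathcal{S}_r(v)]$. $\delta(H)$ denotes the minimum degree of a graph $H$. -}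

module Defs where

open import Data.Nat using (ℕ; zero; suc; _+_; _≤_)
open import Data.Bool using (Bool; true; false; _∧_; _∨_; not; if_then_else_)
open import Data.Fin using (Fin; zero; suc)
open import Data.Fin.Properties using (_≟_)
open import Relation.Nullary.Decidable using (does)
open import Relation.Binary.PropositionalEquality using (_≡_; _≢_)
open import Data.Product using (Σ; _×_; ∃; ∃-syntax)
open import Data.Nat using (_⊓_)

record Graph (n : ℕ) : Set where
  field
    adj    : Fin n → Fin n → Bool
    sym    : ∀ u v → adj u v ≡ adj v u
    irrefl : ∀ v → adj v v ≡ false
open Graph public

countFin : ∀ {n} → (Fin n → Bool) → ℕ
countFin {zero}  f = 0
countFin {suc n} f = (if f zero then 1 else 0) + countFin (λ i → f (suc i))

anyFin : ∀ {n} → (Fin n → Bool) → Bool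
anyFin {zero}  f = false
anyFin {suc n} f = f zero ∨ anyFin (λ i → f (suc i))

-- minimum of g over {i | p i = true}; the value for empty p is irrelevant
-- (only used when p is nonempty) and is set to 0.
minOver : ∀ {n} → (Fin n → Bool) → (Fin n → ℕ) → ℕ
minOver {zero}  p g = 0
minOver {suc n} p g with p zero | anyFin (λ i → p (suc i))
... | true  | true  = g zero ⊓ minOver (λ i → p (suc i)) (λ i → g (suc i))
... | true  | false = g zero
... | false | _     = minOver (λ i → p (suc i)) (λ i → g (suc i))

module _ {n : ℕ} (G : Graph n) where

  degree : Fin n → ℕ
  degree v = countFin (adj G v)

  -- withinDist k v w = true  iff  d(v,w) ≤ k  (there is a walk of length ≤ k)
  withinDist : ℕ → Fin n → Fin n → Bool
  withinDist zero    v w = does (v ≟ w)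
  withinDist (suc k) v w = withinDist k v w ∨ anyFin (λ u → withinDist k v u ∧ adj G u w)

  distIs : ℕ → Fin n → Fin n → Bool
  distIs zero    v w = withinDist zero v w
  distIs (suc k) v w = withinDist (suc k) v w ∧ not (withinDist k v w)

  sphere : Fin n → ℕ → Fin n → Bool
  sphere v r = distIs r v

  SphereNonempty : Fin n → ℕ → Set
  SphereNonempty v r = ∃[ w ] sphere v r w ≡ true

  -- degree of u inside the r-link graph L_r(v) = G[S_r(v)]
  linkDegree : Fin n → ℕ → Fin n → ℕ
  linkDegree v r u = countFin (λ w → sphere v r w ∧ adj G u w)

  -- δ(L_r(v)) (meaningful when S_r(v) ≠ ∅)
  minDegLink : Fin n → ℕ → ℕ
  minDegLink v r = minOver (sphere v r) (linkDegree v r)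

  Connected : Set
  Connected = ∀ v w → ∃[ k ] withinDist k v w ≡ true

  Regular : ℕ → Set
  Regular d = ∀ v → degree v ≡ d

  NotComplete : Set
  NotComplete = ∃[ v ] ∃[ w ] (v ≢ w × adj G v w ≡ false)

-- A connected non-complete graph contains an induced path x ∼ u ∼ y. Sorting the neighbours of u,
-- the neighbours of y and the common neighbours of u and y by their distance from x gives
-- δ(L₁(x)) + δ(L₁(u)) + δ(L₂(x)) + 3 ≤ 2d, so one of these three link graphs has minimum degree at
-- most ⌊2d/3⌋ − 1. For d = 3q + 2 the bound is attained by the 5-cycle with every vertex blown up
-- into a clique on q + 1 vertices: it has diameter 2, adjacent vertices have at least 2q common
-- neighbours, and a vertex at distance 2 from v has at least 2q + 1 neighbours outside the closed
-- neighbourhood of v.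

module Submission where

open import Defs hiding (sym)
open import Data.Nat using (ℕ; zero; suc; _+_; _*_; _≤_; _<_; _⊓_; z≤n; s≤s; NonZero)
import Data.Nat as ℕ
open import Data.Nat.Properties
  using ( ≤-refl; ≤-trans; ≤-antisym; ≤-reflexive; n≤1+n; +-mono-≤; +-monoˡ-≤; +-monoʳ-≤; *-monoʳ-≤
        ; +-assoc; +-cancelˡ-≤; +-cancelˡ-≡; +-identityʳ; +-suc; suc-injective
        ; m⊓n≤m; m⊓n≤n; ⊓-glb; ⊓-sel; module ≤-Reasoning)
open import Data.Nat.DivMod using (_/_; _%_; /-monoˡ-≤; m*n/n≡m; +-distrib-/-∣ʳ; m≡m%n+[m/n]*n)
open import Data.Nat.Divisibility using (n∣m*n)
open import Data.Nat.Tactic.RingSolver using (solve-∀)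
open import Data.Bool using (Bool; true; false; _∧_; _∨_; not; if_then_else_)
import Data.Bool.Properties as Bool
open import Algebra.Bundles using (CommutativeMonoid)
open import Algebra.Properties.CommutativeSemigroup
  (CommutativeMonoid.commutativeSemigroup Bool.∧-commutativeMonoid)
  using () renaming (interchange to ∧-interchange)
open import Data.Fin using (Fin; zero; suc; toℕ; _↑ˡ_; _↑ʳ_; combine; quotient; remainder)
open import Data.Fin.Patterns using (0F; 1F; 2F)
open import Data.Fin.Properties using (_≟_; all?; any?; remQuot-combine)
open import Data.Product using (Σ; _×_; ∃; ∃-syntax; _,_; proj₂)
open import Data.Sum using (_⊎_; inj₁; inj₂)
open import Data.Empty using (⊥-elim)
open import Function.Bundles using (mk⇔)
open import Relation.Nullary using (yes; no)
open import Relation.Nullary.Decidable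
  using (does; dec-true; dec-false; does-⇔; from-yes; _×-dec_; _→-dec_)
open import Relation.Binary.PropositionalEquality
  using (_≡_; _≢_; refl; sym; trans; cong; cong₂; subst; module ≡-Reasoning)

private variable
  a b : Bool
  n : ℕ

∧-true : a ≡ true → b ≡ true → a ∧ b ≡ true
∧-true refl refl = refl

∧-true⁻ˡ : a ∧ b ≡ true → a ≡ true
∧-true⁻ˡ = Bool.∧-conicalˡ _ _

∧-true⁻ʳ : a ∧ b ≡ true → b ≡ true
∧-true⁻ʳ = Bool.∧-conicalʳ _ _

∨-trueʳ : b ≡ true → a ∨ b ≡ true
∨-trueʳ {a = true}  _ = refl
∨-trueʳ {a = false} e = e

∨-trueˡ : a ≡ true → a ∨ b ≡ true
∨-trueˡ refl = refl

∨-true⁻ : a ∨ b ≡ true → a ≡ true ⊎ b ≡ true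
∨-true⁻ {a = true}  _ = inj₁ refl
∨-true⁻ {a = false} e = inj₂ e

not-true⁻ : not a ≡ true → a ≡ false
not-true⁻ {a = false} _ = refl

true≢false : a ≡ true → a ≢ false
true≢false refl ()

≟-true⁻ : {v w : Fin n} → does (v ≟ w) ≡ true → v ≡ w
≟-true⁻ {v = v} {w} e with v ≟ w
... | yes v≡w = v≡w

≟-refl : (v : Fin n) → does (v ≟ v) ≡ true
≟-refl v = dec-true (v ≟ v) refl

-- Counting and minimising over Fin n

countFin-cong : (f g : Fin n → Bool) → (∀ i → f i ≡ g i) → countFin f ≡ countFin g
countFin-cong {zero}  f g f≗g = refl
countFin-cong {suc n} f g f≗g rewrite f≗g zero =
  cong (_ +_) (countFin-cong (λ i → f (suc i)) (λ i → g (suc i)) (λ i → f≗g (suc i)))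

countFin-mono : (f g : Fin n → Bool) → (∀ i → f i ≡ true → g i ≡ true) → countFin f ≤ countFin g
countFin-mono {zero}  f g f⊆g = z≤n
countFin-mono {suc n} f g f⊆g
  with countFin-mono (λ i → f (suc i)) (λ i → g (suc i)) (λ i → f⊆g (suc i)) | f zero in f₀ | g zero in g₀
... | tail | true  | true  = s≤s tail
... | _    | true  | false = ⊥-elim (true≢false (f⊆g zero f₀) g₀)
... | tail | false | true  = ≤-trans tail (n≤1+n _)
... | tail | false | false = tail

countFin-split : (f g : Fin n → Bool) →
  countFin f ≡ countFin (λ i → f i ∧ g i) + countFin (λ i → f i ∧ not (g i))
countFin-split {zero}  f g = refl
countFin-split {suc n} f g with f zero | g zero
... | true  | true  = cong suc (countFin-split (λ i → f (suc i)) (λ i → g (suc i)))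
... | true  | false = trans (cong suc (countFin-split (λ i → f (suc i)) (λ i → g (suc i)))) (sym (+-suc _ _))
... | false | _     = countFin-split (λ i → f (suc i)) (λ i → g (suc i))

countFin-disjoint : (f g h : Fin n → Bool) → (∀ i → f i ≡ true → h i ≡ true) →
  (∀ i → g i ≡ true → h i ≡ true) → (∀ i → f i ≡ true → g i ≡ false) →
  countFin f + countFin g ≤ countFin h
countFin-disjoint f g h f⊆h g⊆h f∩g=∅ = subst (_ ≤_) (sym (countFin-split h f))
  (+-mono-≤ (countFin-mono f _ (λ i fi → ∧-true (f⊆h i fi) fi))
            (countFin-mono g _ (λ i gi → ∧-true (g⊆h i gi) (cong not (g⇒¬f i gi)))))
  where
  g⇒¬f : ∀ i → g i ≡ true → f i ≡ false
  g⇒¬f i gi with f i in fi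
  ... | true  = ⊥-elim (true≢false gi (f∩g=∅ i fi))
  ... | false = refl

countFin-union : (f g h : Fin n → Bool) → (∀ i → h i ≡ true → f i ≡ true ⊎ g i ≡ true) →
  countFin h ≤ countFin f + countFin g
countFin-union f g h h⊆f∪g = subst (_≤ _) (sym (countFin-split h f))
  (+-mono-≤ (countFin-mono _ f (λ i → ∧-true⁻ʳ)) (countFin-mono _ g h∖f⊆g))
  where
  h∖f⊆g : ∀ i → h i ∧ not (f i) ≡ true → g i ≡ true
  h∖f⊆g i e with h⊆f∪g i (∧-true⁻ˡ e)
  ... | inj₁ fi = ⊥-elim (true≢false fi (not-true⁻ (∧-true⁻ʳ e)))
  ... | inj₂ gi = gi

countFin-≟ : (j : Fin n) → countFin (λ i → does (j ≟ i)) ≡ 1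
countFin-≟ {suc n} zero    = cong suc (countFin-const-false n)
  where
  countFin-const-false : ∀ n → countFin {n} (λ _ → false) ≡ 0
  countFin-const-false zero    = refl
  countFin-const-false (suc n) = countFin-const-false n
countFin-≟ {suc n} (suc j) = countFin-≟ j

countFin-remove : (f : Fin n → Bool) (j : Fin n) → f j ≡ true →
  countFin f ≡ suc (countFin (λ i → f i ∧ not (does (j ≟ i))))
countFin-remove f j fj = begin
  countFin f                                  ≡⟨ countFin-split f (λ i → does (j ≟ i)) ⟩
  countFin (λ i → f i ∧ does (j ≟ i)) + rest ≡⟨ cong (_+ rest) (countFin-cong _ _ only-j) ⟩
  countFin (λ i → does (j ≟ i)) + rest       ≡⟨ cong (_+ rest) (countFin-≟ j) ⟩
  suc rest                                    ∎
  where
  open ≡-Reasoning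
  rest = countFin (λ i → f i ∧ not (does (j ≟ i)))
  only-j : ∀ i → f i ∧ does (j ≟ i) ≡ does (j ≟ i)
  only-j i with j ≟ i
  ... | yes refl = trans (Bool.∧-identityʳ (f j)) fj
  ... | no  _    = Bool.∧-zeroʳ (f i)

countFin-< : (f g : Fin n → Bool) (j : Fin n) → (∀ i → g i ≡ true → f i ≡ true) →
  f j ≡ true → g j ≡ false → countFin g < countFin f
countFin-< f g j g⊆f fj ¬gj = subst (countFin g <_) (sym (countFin-remove f j fj))
  (s≤s (countFin-mono g _ λ i gi → ∧-true (g⊆f i gi) (cong not (dec-false (j ≟ i) (j≢i i gi)))))
  where
  j≢i : ∀ i → g i ≡ true → j ≢ i
  j≢i i gi refl = true≢false gi ¬gj

countFin-↑ : ∀ k m (f : Fin (k + m) → Bool) →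
  countFin f ≡ countFin (λ i → f (i ↑ˡ m)) + countFin (λ i → f (k ↑ʳ i))
countFin-↑ zero    m f = refl
countFin-↑ (suc k) m f = trans (cong ((if f zero then 1 else 0) +_) (countFin-↑ k m (λ i → f (suc i))))
  (sym (+-assoc (if f zero then 1 else 0) _ _))

countFin-combine : ∀ t k (f : Fin (t * k) → Bool) c →
  (∀ i → countFin (λ j → f (combine {t} {k} i j)) ≡ c) → countFin f ≡ t * c
countFin-combine zero    k f c rows = refl
countFin-combine (suc t) k f c rows = trans (countFin-↑ k (t * k) f)
  (cong₂ _+_ (rows zero) (countFin-combine t k (λ i → f (k ↑ʳ i)) c (λ i → rows (suc i))))

anyFin-intro : (f : Fin n → Bool) (i : Fin n) → f i ≡ true → anyFin f ≡ true
anyFin-intro f zero    fi rewrite fi = refl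
anyFin-intro f (suc i) fi = ∨-trueʳ (anyFin-intro (λ i → f (suc i)) i fi)

anyFin-witness : (f : Fin n → Bool) → anyFin f ≡ true → ∃ λ i → f i ≡ true
anyFin-witness {suc n} f e with f zero in f₀
... | true  = zero , f₀
... | false with anyFin-witness (λ i → f (suc i)) e
...   | i , fi = suc i , fi

anyFin-≟ : (f : Fin n → Bool) (v : Fin n) → anyFin (λ u → does (v ≟ u) ∧ f u) ≡ f v
anyFin-≟ f v with f v in fv | anyFin (λ u → does (v ≟ u) ∧ f u) in any
... | true  | true  = refl
... | true  | false = ⊥-elim (true≢false (anyFin-intro _ v (∧-true (≟-refl v) fv)) any)
... | false | false = refl
... | false | true  with anyFin-witness _ any
...   | u , e with ≟-true⁻ {v = v} {u} (∧-true⁻ˡ e)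
...     | refl = ⊥-elim (true≢false (∧-true⁻ʳ e) fv)

minOver-≤ : (p : Fin n → Bool) (g : Fin n → ℕ) (i : Fin n) → p i ≡ true → minOver p g ≤ g i
minOver-≤ {suc n} p g zero pi with p zero | anyFin (λ i → p (suc i))
... | true  | true  = m⊓n≤m _ _
... | true  | false = ≤-refl
minOver-≤ {suc n} p g (suc i) pi with p zero | anyFin (λ i → p (suc i)) in any
... | true  | true  = ≤-trans (m⊓n≤n _ _) (minOver-≤ (λ i → p (suc i)) (λ i → g (suc i)) i pi)
... | true  | false = ⊥-elim (true≢false (anyFin-intro (λ i → p (suc i)) i pi) any)
... | false | _     = minOver-≤ (λ i → p (suc i)) (λ i → g (suc i)) i pi

minOver-glb : (p : Fin n → Bool) (g : Fin n → ℕ) (m : ℕ) → (∃ λ i → p i ≡ true) →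
  (∀ i → p i ≡ true → m ≤ g i) → m ≤ minOver p g
minOver-glb {suc n} p g m (i , pi) m≤g with p zero in p₀ | anyFin (λ i → p (suc i)) in any
... | true  | true  = ⊓-glb (m≤g zero p₀) (minOver-glb (λ i → p (suc i)) (λ i → g (suc i)) m
                        (anyFin-witness _ any) (λ i → m≤g (suc i)))
... | true  | false = m≤g zero p₀
... | false | _     with i
...   | zero   = ⊥-elim (true≢false pi p₀)
...   | suc i′ = minOver-glb (λ i → p (suc i)) (λ i → g (suc i)) m (i′ , pi) (λ i → m≤g (suc i))

-- Small distances

module _ (G : Graph n) where

  adj-sym : {v w : Fin n} → adj G v w ≡ true → adj G w v ≡ true
  adj-sym {v} {w} e = trans (Graph.sym G w v) e

  adj⇒≢ : {v w : Fin n} → adj G v w ≡ true → v ≢ w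
  adj⇒≢ {v} e refl = true≢false e (Graph.irrefl G v)

  withinDist₁ : (v w : Fin n) → withinDist G 1 v w ≡ does (v ≟ w) ∨ adj G v w
  withinDist₁ v w = cong (does (v ≟ w) ∨_) (anyFin-≟ (λ u → adj G u w) v)

  sphere₁ : (v w : Fin n) → sphere G v 1 w ≡ adj G v w
  sphere₁ v w rewrite withinDist₁ v w with v ≟ w
  ... | yes refl = sym (Graph.irrefl G v)
  ... | no  _    = Bool.∧-identityʳ (adj G v w)

  sphere₂ : (v w : Fin n) → sphere G v 2 w ≡ withinDist G 2 v w ∧ not (does (v ≟ w) ∨ adj G v w)
  sphere₂ v w = cong (λ b → withinDist G 2 v w ∧ not b) (withinDist₁ v w)

  withinDist₂-intro : {v u w : Fin n} → adj G v u ≡ true → adj G u w ≡ true →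
    withinDist G 2 v w ≡ true
  withinDist₂-intro {v} {u} {w} vu uw =
    ∨-trueʳ (anyFin-intro _ u (∧-true (trans (withinDist₁ v u) (∨-trueʳ vu)) uw))

  sphere₂-intro : {v w : Fin n} → withinDist G 2 v w ≡ true → v ≢ w → adj G v w ≡ false →
    sphere G v 2 w ≡ true
  sphere₂-intro {v} {w} within v≢w v≁w = trans (sphere₂ v w)
    (∧-true within (cong not (cong₂ _∨_ (dec-false (v ≟ w) v≢w) v≁w)))

  sphere₂⇒≢ : {v w : Fin n} → sphere G v 2 w ≡ true → v ≢ w
  sphere₂⇒≢ {v} {w} e refl = true≢false (≟-refl v)
    (Bool.∨-conicalˡ _ (adj G v v)
      (not-true⁻ (∧-true⁻ʳ {a = withinDist G 2 v v} (trans (sym (sphere₂ v v)) e))))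

  sphere₂⇒≁ : {v w : Fin n} → sphere G v 2 w ≡ true → adj G v w ≡ false
  sphere₂⇒≁ {v} {w} e = Bool.∨-conicalʳ (does (v ≟ w)) _
    (not-true⁻ (∧-true⁻ʳ {a = withinDist G 2 v w} (trans (sym (sphere₂ v w)) e)))

record InducedP₃ (G : Graph n) : Set where
  field
    x u y : Fin n
    x∼u   : adj G x u ≡ true
    u∼y   : adj G u y ≡ true
    x≢y   : x ≢ y
    x≁y   : adj G x y ≡ false

module _ (G : Graph n) where

  private
    extend : {v u w : Fin n} → withinDist G 1 v u ≡ true → adj G u w ≡ true →
      withinDist G 1 v w ≡ true ⊎ InducedP₃ G
    extend {v} {u} {w} vu uw with ∨-true⁻ (trans (sym (withinDist₁ G v u)) vu)
    ... | inj₁ v≡u rewrite ≟-true⁻ {v = v} {u} v≡u = inj₁ (trans (withinDist₁ G u w) (∨-trueʳ uw))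
    ... | inj₂ v∼u with v ≟ w | adj G v w in v∼w
    ...   | yes _   | _     = inj₁ refl
    ...   | no  _   | true  = inj₁ (anyFin-intro _ v (∧-true (≟-refl v) v∼w))
    ...   | no  v≢w | false = inj₂ (record { x∼u = v∼u ; u∼y = uw ; x≢y = v≢w ; x≁y = v∼w })

  withinDist⇒withinDist₁-or-inducedP₃ : ∀ k {v w} → withinDist G k v w ≡ true →
    withinDist G 1 v w ≡ true ⊎ InducedP₃ G
  withinDist⇒withinDist₁-or-inducedP₃ zero    e = inj₁ (∨-trueˡ e)
  withinDist⇒withinDist₁-or-inducedP₃ (suc k) {v} {w} e with ∨-true⁻ e
  ... | inj₁ within-k = withinDist⇒withinDist₁-or-inducedP₃ k within-k
  ... | inj₂ step with anyFin-witness (λ u → withinDist G k v u ∧ adj G u w) step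
  ...   | u , vu∼w with withinDist⇒withinDist₁-or-inducedP₃ k (∧-true⁻ˡ vu∼w)
  ...     | inj₂ P  = inj₂ P
  ...     | inj₁ vu = extend {v} {u} {w} vu (∧-true⁻ʳ vu∼w)

  inducedP₃ : Connected G → NotComplete G → InducedP₃ G
  inducedP₃ connected (v , w , v≢w , v≁w) with connected v w
  ... | k , within with withinDist⇒withinDist₁-or-inducedP₃ k within
  ...   | inj₂ P  = P
  ...   | inj₁ vw =
    ⊥-elim (true≢false vw (trans (withinDist₁ G v w) (cong₂ _∨_ (dec-false (v ≟ w) v≢w) v≁w)))

m*n≤o⇒m≤o/n : ∀ k m {q} .{{_ : NonZero q}} → k * q ≤ m → k ≤ m / q
m*n≤o⇒m≤o/n k m {q} h = subst (_≤ m / q) (m*n/n≡m k q) (/-monoˡ-≤ q h)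

⊓₃-bound : ∀ a b c m → a + b + c + 3 ≤ m → a ⊓ (b ⊓ c) + 1 ≤ m / 3
⊓₃-bound a b c m h = m*n≤o⇒m≤o/n (μ + 1) m (begin
  (μ + 1) * 3       ≡⟨ expand μ ⟩
  μ + μ + μ + 3     ≤⟨ +-monoˡ-≤ 3 (+-mono-≤ (+-mono-≤ μ≤a μ≤b) μ≤c) ⟩
  a + b + c + 3     ≤⟨ h ⟩
  m                 ∎)
  where
  open ≤-Reasoning
  μ : ℕ
  μ = a ⊓ (b ⊓ c)
  μ≤a μ≤b μ≤c : μ ≤ _
  μ≤a = m⊓n≤m a (b ⊓ c)
  μ≤b = ≤-trans (m⊓n≤n a (b ⊓ c)) (m⊓n≤m b c)
  μ≤c = ≤-trans (m⊓n≤n a (b ⊓ c)) (m⊓n≤n b c)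
  expand : ∀ μ → (μ + 1) * 3 ≡ μ + μ + μ + 3
  expand = solve-∀

some-summand-bound : ∀ a b c m → a + b + c + 3 ≤ m →
  a + 1 ≤ m / 3 ⊎ b + 1 ≤ m / 3 ⊎ c + 1 ≤ m / 3
some-summand-bound a b c m h with ⊓-sel a (b ⊓ c) | ⊓-sel b c
... | inj₁ μ≡a  | _        = inj₁ (subst (λ k → k + 1 ≤ m / 3) μ≡a (⊓₃-bound a b c m h))
... | inj₂ μ≡bc | inj₁ bc≡b =
  inj₂ (inj₁ (subst (λ k → k + 1 ≤ m / 3) (trans μ≡bc bc≡b) (⊓₃-bound a b c m h)))
... | inj₂ μ≡bc | inj₂ bc≡c =
  inj₂ (inj₂ (subst (λ k → k + 1 ≤ m / 3) (trans μ≡bc bc≡c) (⊓₃-bound a b c m h)))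

-- Counting around an induced path x ∼ u ∼ y in a d-regular graph

module InducedP₃-counting {G : Graph n} {d : ℕ} (regular : Regular G d) (P : InducedP₃ G) where
  open InducedP₃ P

  private
    S₁ S₂ : Fin n → Bool
    S₁ = sphere G x 1
    S₂ = sphere G x 2

    N : Fin n → Fin n → Bool
    N = adj G

    C₁ C₂ : ℕ
    C₁ = countFin (λ w → (S₁ w ∧ N u w) ∧ N y w)
    C₂ = countFin (λ w → (S₂ w ∧ N u w) ∧ N y w)

    S₁⇒¬S₂ : ∀ w → S₁ w ≡ true → S₂ w ≡ false
    S₁⇒¬S₂ w s₁ with S₂ w in s₂
    ... | true  = ⊥-elim (true≢false (trans (sym (sphere₁ G x w)) s₁) (sphere₂⇒≁ G s₂))
    ... | false = refl

    S₁⇒≢x : ∀ w → S₁ w ≡ true → does (x ≟ w) ≡ false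
    S₁⇒≢x w s₁ = dec-false (x ≟ w) (adj⇒≢ G (trans (sym (sphere₁ G x w)) s₁))

    S₂⇒≢x : ∀ w → S₂ w ≡ true → does (x ≟ w) ≡ false
    S₂⇒≢x w s₂ = dec-false (x ≟ w) (sphere₂⇒≢ G s₂)

  u∈S₁[x] : sphere G x 1 u ≡ true
  u∈S₁[x] = trans (sphere₁ G x u) x∼u

  y∈S₁[u] : sphere G u 1 y ≡ true
  y∈S₁[u] = trans (sphere₁ G u y) u∼y

  y∈S₂[x] : sphere G x 2 y ≡ true
  y∈S₂[x] = sphere₂-intro G (withinDist₂-intro G x∼u u∼y) x≢y x≁y

  neighbours-of-u : suc (linkDegree G x 1 u + countFin (λ w → S₂ w ∧ N u w)) ≤ d
  neighbours-of-u = begin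
    suc (countFin (λ w → S₁ w ∧ N u w) + countFin (λ w → S₂ w ∧ N u w))
      ≤⟨ s≤s (countFin-disjoint _ _ N[u]∖x
           (λ w e → ∧-true (∧-true⁻ʳ e) (cong not (S₁⇒≢x w (∧-true⁻ˡ e))))
           (λ w e → ∧-true (∧-true⁻ʳ e) (cong not (S₂⇒≢x w (∧-true⁻ˡ e))))
           (λ w e → cong (_∧ N u w) (S₁⇒¬S₂ w (∧-true⁻ˡ e)))) ⟩
    suc (countFin N[u]∖x)  ≡⟨ countFin-remove (N u) x (adj-sym G x∼u) ⟨
    degree G u             ≡⟨ regular u ⟩
    d                      ∎
    where
    open ≤-Reasoning
    N[u]∖x : Fin n → Bool
    N[u]∖x w = N u w ∧ not (does (x ≟ w))

  common-neighbours-of-u-and-y : linkDegree G u 1 y ≤ C₁ + C₂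
  common-neighbours-of-u-and-y = countFin-union _ _ _ by-distance-from-x
    where
    by-adjacency-to-x : ∀ w → N u w ≡ true → N y w ≡ true →
      (S₁ w ∧ N u w) ∧ N y w ≡ true ⊎ (S₂ w ∧ N u w) ∧ N y w ≡ true
    by-adjacency-to-x w u∼w y∼w with N x w in x∼w
    ... | true  = inj₁ (∧-true (∧-true (trans (sphere₁ G x w) x∼w) u∼w) y∼w)
    ... | false = inj₂ (∧-true (∧-true S₂w u∼w) y∼w)
      where
      S₂w : S₂ w ≡ true
      S₂w = sphere₂-intro G (withinDist₂-intro G x∼u u∼w)
        (λ { refl → true≢false (adj-sym G y∼w) x≁y }) x∼w
    by-distance-from-x : ∀ w → sphere G u 1 w ∧ N y w ≡ true →
      (S₁ w ∧ N u w) ∧ N y w ≡ true ⊎ (S₂ w ∧ N u w) ∧ N y w ≡ true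
    by-distance-from-x w e =
      by-adjacency-to-x w (trans (sym (sphere₁ G u w)) (∧-true⁻ˡ e)) (∧-true⁻ʳ {a = sphere G u 1 w} e)

  y-not-common : suc C₂ ≤ countFin (λ w → S₂ w ∧ N u w)
  y-not-common = countFin-< _ _ y (λ w → ∧-true⁻ˡ) (∧-true y∈S₂[x] u∼y)
    (trans (cong ((S₂ y ∧ N u y) ∧_) (Graph.irrefl G y)) (Bool.∧-zeroʳ _))

  neighbours-of-y : suc (C₁ + linkDegree G x 2 y) ≤ d
  neighbours-of-y = begin
    suc C₁ + countFin (λ w → S₂ w ∧ N y w)
      ≤⟨ +-monoˡ-≤ _ u-not-common ⟩
    countFin (λ w → S₁ w ∧ N y w) + countFin (λ w → S₂ w ∧ N y w)
      ≤⟨ countFin-disjoint _ _ (N y) (λ w → ∧-true⁻ʳ) (λ w → ∧-true⁻ʳ)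
           (λ w e → cong (_∧ N y w) (S₁⇒¬S₂ w (∧-true⁻ˡ e))) ⟩
    degree G y
      ≡⟨ regular y ⟩
    d ∎
    where
    open ≤-Reasoning
    u-not-common : suc C₁ ≤ countFin (λ w → S₁ w ∧ N y w)
    u-not-common = countFin-< (λ w → S₁ w ∧ N y w) (λ w → (S₁ w ∧ N u w) ∧ N y w) u
      (λ w e → ∧-true (∧-true⁻ˡ {a = S₁ w} (∧-true⁻ˡ {a = S₁ w ∧ N u w} e))
                      (∧-true⁻ʳ {a = S₁ w ∧ N u w} e))
      (∧-true u∈S₁[x] (adj-sym G u∼y))
      (trans (cong (λ b → (S₁ u ∧ b) ∧ N y u) (Graph.irrefl G u)) (cong (_∧ N y u) (Bool.∧-zeroʳ _)))

  linkDegree-sum : linkDegree G x 1 u + linkDegree G u 1 y + linkDegree G x 2 y + 3 ≤ 2 * d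
  linkDegree-sum = begin
    ℓ₁ + ℓ₂ + ℓ₃ + 3
      ≤⟨ +-monoˡ-≤ 3 (+-monoˡ-≤ ℓ₃ (+-monoʳ-≤ ℓ₁ common-neighbours-of-u-and-y)) ⟩
    ℓ₁ + (C₁ + C₂) + ℓ₃ + 3
      ≡⟨ regroup ℓ₁ C₁ C₂ ℓ₃ ⟩
    suc (ℓ₁ + suc C₂) + suc (C₁ + ℓ₃)
      ≤⟨ +-mono-≤ (s≤s (+-monoʳ-≤ ℓ₁ y-not-common)) neighbours-of-y ⟩
    suc (ℓ₁ + countFin (λ w → S₂ w ∧ N u w)) + d
      ≤⟨ +-monoˡ-≤ d neighbours-of-u ⟩
    d + d
      ≡⟨ cong (d +_) (sym (+-identityʳ d)) ⟩
    2 * d ∎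
    where
    open ≤-Reasoning
    ℓ₁ ℓ₂ ℓ₃ : ℕ
    ℓ₁ = linkDegree G x 1 u
    ℓ₂ = linkDegree G u 1 y
    ℓ₃ = linkDegree G x 2 y
    regroup : ∀ a C₁ C₂ c → a + (C₁ + C₂) + c + 3 ≡ suc (a + suc C₂) + suc (C₁ + c)
    regroup = solve-∀

  minDegLink-sum : minDegLink G x 1 + minDegLink G u 1 + minDegLink G x 2 + 3 ≤ 2 * d
  minDegLink-sum = ≤-trans
    (+-monoˡ-≤ 3 (+-mono-≤ (+-mono-≤ (minOver-≤ _ _ u u∈S₁[x]) (minOver-≤ _ _ y y∈S₁[u]))
                           (minOver-≤ _ _ y y∈S₂[x])))
    linkDegree-sum

  sparse-link : ∃[ v ] ∃[ r ] (1 ≤ r × SphereNonempty G v r × minDegLink G v r + 1 ≤ (2 * d) / 3)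
  sparse-link with some-summand-bound _ _ _ _ minDegLink-sum
  ... | inj₁ bound        = x , 1 , s≤s z≤n , (u , u∈S₁[x]) , bound
  ... | inj₂ (inj₁ bound) = u , 1 , s≤s z≤n , (y , y∈S₁[u]) , bound
  ... | inj₂ (inj₂ bound) = x , 2 , s≤s z≤n , (y , y∈S₂[x]) , bound

minDegLink-bound : ∀ (d : ℕ) → 1 ≤ d → (n : ℕ) → (G : Graph n) →
  Connected G → Regular G d → NotComplete G →
  ∃[ v ] ∃[ r ] (1 ≤ r × SphereNonempty G v r × minDegLink G v r + 1 ≤ (2 * d) / 3)
minDegLink-bound d _ n G connected regular notComplete =
  InducedP₃-counting.sparse-link regular (inducedP₃ G connected notComplete)

-- Blowing up the vertices of a graph into cliques

-- N is the closed-neighbourhood relation of a graph H on Fin k; each vertex of H becomes a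
-- clique on t vertices, and cliques of adjacent vertices are completely joined.
module Blowup {k : ℕ} (N : Fin k → Fin k → Bool) (N-refl : ∀ a → N a a ≡ true)
              (N-sym : ∀ a b → N a b ≡ N b a) (t : ℕ) where

  part : Fin (t * k) → Fin k
  part = remainder {t} k

  part-combine : (i : Fin t) (a : Fin k) → part (combine i a) ≡ a
  part-combine i a = cong proj₂ (remQuot-combine {t} {k} i a)

  blowup : Graph (t * k)
  blowup = record
    { adj    = λ v w → N (part v) (part w) ∧ not (does (v ≟ w))
    ; sym    = λ v w → cong₂ (λ b c → b ∧ not c) (N-sym (part v) (part w))
                         (does-⇔ (mk⇔ sym sym) (v ≟ w) (w ≟ v))
    ; irrefl = λ v → trans (cong (λ b → N (part v) (part v) ∧ not b) (≟-refl v)) (Bool.∧-zeroʳ _)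
    }

  adj-intro : {v w : Fin (t * k)} → N (part v) (part w) ≡ true → v ≢ w → adj blowup v w ≡ true
  adj-intro {v} {w} e v≢w = ∧-true e (cong not (dec-false (v ≟ w) v≢w))

  countFin-part : (g : Fin k → Bool) → countFin (λ w → g (part w)) ≡ t * countFin g
  countFin-part g = countFin-combine t k (λ w → g (part w)) (countFin g)
    (λ i → countFin-cong _ g (λ a → cong g (part-combine i a)))

  degree-blowup : ∀ v → suc (degree blowup v) ≡ t * countFin (N (part v))
  degree-blowup v = begin
    suc (countFin (λ w → N (part v) (part w) ∧ not (does (v ≟ w))))
      ≡⟨ countFin-remove (λ w → N (part v) (part w)) v (N-refl (part v)) ⟨
    countFin (λ w → N (part v) (part w))
      ≡⟨ countFin-part (N (part v)) ⟩
    t * countFin (N (part v)) ∎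
    where open ≡-Reasoning

  link₁-blowup : ∀ v u → adj blowup v u ≡ true →
    2 + linkDegree blowup v 1 u ≡ t * countFin (λ c → N (part v) c ∧ N (part u) c)
  link₁-blowup v u v∼u = begin
    2 + countFin (λ w → sphere blowup v 1 w ∧ adj blowup u w)
      ≡⟨ cong (2 +_) (countFin-cong _ _ regroup) ⟩
    2 + countFin (λ w → (F w ∧ not (does (v ≟ w))) ∧ not (does (u ≟ w)))
      ≡⟨ cong suc (countFin-remove (λ w → F w ∧ not (does (v ≟ w))) u
           (∧-true (∧-true (∧-true⁻ˡ {b = not (does (v ≟ u))} v∼u) (N-refl (part u)))
                   (∧-true⁻ʳ {a = N (part v) (part u)} v∼u))) ⟨
    suc (countFin (λ w → F w ∧ not (does (v ≟ w))))
      ≡⟨ countFin-remove F v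
           (∧-true (N-refl (part v)) (trans (N-sym _ _) (∧-true⁻ˡ {b = not (does (v ≟ u))} v∼u))) ⟨
    countFin F
      ≡⟨ countFin-part (λ c → N (part v) c ∧ N (part u) c) ⟩
    t * countFin (λ c → N (part v) c ∧ N (part u) c) ∎
    where
    open ≡-Reasoning
    F : Fin (t * k) → Bool
    F w = N (part v) (part w) ∧ N (part u) (part w)
    regroup : ∀ w →
      sphere blowup v 1 w ∧ adj blowup u w ≡ (F w ∧ not (does (v ≟ w))) ∧ not (does (u ≟ w))
    regroup w = begin
      sphere blowup v 1 w ∧ adj blowup u w
        ≡⟨ cong (_∧ adj blowup u w) (sphere₁ blowup v w) ⟩
      (N (part v) (part w) ∧ not (does (v ≟ w))) ∧ (N (part u) (part w) ∧ not (does (u ≟ w)))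
        ≡⟨ ∧-interchange (N (part v) (part w)) _ (N (part u) (part w)) _ ⟩
      F w ∧ (not (does (v ≟ w)) ∧ not (does (u ≟ w)))
        ≡⟨ Bool.∧-assoc (F w) _ _ ⟨
      (F w ∧ not (does (v ≟ w))) ∧ not (does (u ≟ w)) ∎

  module _ (N-diameter₂ : ∀ a b → N a b ≡ false → ∃ λ m → N a m ≡ true × N m b ≡ true) where

    withinDist₂-blowup : ∀ v w → withinDist blowup 2 v w ≡ true
    withinDist₂-blowup v w with N (part v) (part w) in N[v,w]
    ... | true  = ∨-trueˡ (trans (withinDist₁ blowup v w)
                    (trans (cong (λ b → does (v ≟ w) ∨ (b ∧ not (does (v ≟ w)))) N[v,w])
                           (Bool.∨-inverseʳ (does (v ≟ w)))))
    ... | false with N-diameter₂ (part v) (part w) N[v,w]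
    ...   | m , N[v,m] , N[m,w] = withinDist₂-intro blowup
            (adj-intro (trans (cong (N (part v)) (part-combine _ m)) N[v,m]) v≢mid)
            (adj-intro (trans (cong (λ a → N a (part w)) (part-combine _ m)) N[m,w]) mid≢w)
      where
      mid : Fin (t * k)
      mid = combine (quotient {t} k v) m
      v≢mid : v ≢ mid
      v≢mid v≡mid = true≢false
        (subst (λ a → N a (part w) ≡ true) (sym (trans (cong part v≡mid) (part-combine _ m))) N[m,w]) N[v,w]
      mid≢w : mid ≢ w
      mid≢w mid≡w = true≢false
        (subst (λ a → N (part v) a ≡ true) (trans (sym (part-combine _ m)) (cong part mid≡w)) N[v,m]) N[v,w]

    withinDist-blowup : ∀ r v w → withinDist blowup (2 + r) v w ≡ true
    withinDist-blowup zero    v w = withinDist₂-blowup v w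
    withinDist-blowup (suc r) v w = ∨-trueˡ (withinDist-blowup r v w)

    sphere-beyond-2 : ∀ r v w → sphere blowup v (3 + r) w ≡ false
    sphere-beyond-2 r v w =
      trans (cong (λ b → withinDist blowup (3 + r) v w ∧ not b) (withinDist-blowup r v w)) (Bool.∧-zeroʳ _)

    sphere₂-blowup : ∀ v w → sphere blowup v 2 w ≡ not (N (part v) (part w))
    sphere₂-blowup v w rewrite sphere₂ blowup v w | withinDist₂-blowup v w with v ≟ w
    ... | yes refl = cong not (sym (N-refl (part v)))
    ... | no  _    = cong not (Bool.∧-identityʳ _)

    link₂-blowup : ∀ v u → N (part v) (part u) ≡ false →
      suc (linkDegree blowup v 2 u) ≡ t * countFin (λ c → not (N (part v) c) ∧ N (part u) c)
    link₂-blowup v u v≁u = begin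
      suc (countFin (λ w → sphere blowup v 2 w ∧ adj blowup u w))
        ≡⟨ cong suc (countFin-cong _ _ regroup) ⟩
      suc (countFin (λ w → F w ∧ not (does (u ≟ w))))
        ≡⟨ countFin-remove F u (∧-true (cong not v≁u) (N-refl (part u))) ⟨
      countFin F
        ≡⟨ countFin-part (λ c → not (N (part v) c) ∧ N (part u) c) ⟩
      t * countFin (λ c → not (N (part v) c) ∧ N (part u) c) ∎
      where
      open ≡-Reasoning
      F : Fin (t * k) → Bool
      F w = not (N (part v) (part w)) ∧ N (part u) (part w)
      regroup : ∀ w → sphere blowup v 2 w ∧ adj blowup u w ≡ F w ∧ not (does (u ≟ w))
      regroup w = trans (cong (_∧ adj blowup u w) (sphere₂-blowup v w))
        (sym (Bool.∧-assoc (not (N (part v) (part w))) (N (part u) (part w)) _))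

-- The blown-up 5-cycle

C₅ : Fin 5 → Fin 5 → Bool
C₅ a b = does (a ≟ b) ∨ does ((toℕ a + 1) % 5 ℕ.≟ toℕ b) ∨ does ((toℕ b + 1) % 5 ℕ.≟ toℕ a)

C₅-refl : ∀ a → C₅ a a ≡ true
C₅-refl = from-yes (all? λ a → C₅ a a Bool.≟ true)

C₅-sym : ∀ a b → C₅ a b ≡ C₅ b a
C₅-sym = from-yes (all? λ a → all? λ b → C₅ a b Bool.≟ C₅ b a)

C₅-degree : ∀ a → countFin (C₅ a) ≡ 3
C₅-degree = from-yes (all? λ a → countFin (C₅ a) ℕ.≟ 3)

C₅-diameter₂ : ∀ a b → C₅ a b ≡ false → ∃ λ m → C₅ a m ≡ true × C₅ m b ≡ true
C₅-diameter₂ = from-yes (all? λ a → all? λ b → (C₅ a b Bool.≟ false) →-dec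
  any? λ m → (C₅ a m Bool.≟ true) ×-dec (C₅ m b Bool.≟ true))

C₅-common : ∀ a b → C₅ a b ≡ true → 2 ≤ countFin (λ c → C₅ a c ∧ C₅ b c)
C₅-common = from-yes (all? λ a → all? λ b → (C₅ a b Bool.≟ true) →-dec
  (2 ℕ.≤? countFin (λ c → C₅ a c ∧ C₅ b c)))

C₅-private : ∀ a b → C₅ a b ≡ false → 2 ≤ countFin (λ c → not (C₅ a c) ∧ C₅ b c)
C₅-private = from-yes (all? λ a → all? λ b → (C₅ a b Bool.≟ false) →-dec
  (2 ℕ.≤? countFin (λ c → not (C₅ a c) ∧ C₅ b c)))

AttainsLinkBound : ℕ → Set
AttainsLinkBound d = ∃[ n ] Σ (Graph n) λ G →
  Connected G × Regular G d × NotComplete G ×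
  (∃[ v ] ∃[ r ] (1 ≤ r × SphereNonempty G v r × minDegLink G v r + 1 ≡ (2 * d) / 3)) ×
  (∀ v r → 1 ≤ r → SphereNonempty G v r → (2 * d) / 3 ≤ minDegLink G v r + 1)

2*[2+q*3]/3≡q+q+1 : ∀ q → (2 * (2 + q * 3)) / 3 ≡ q + q + 1
2*[2+q*3]/3≡q+q+1 q = begin
  (2 * (2 + q * 3)) / 3           ≡⟨ cong (_/ 3) (expand q) ⟩
  (1 + (q + q + 1) * 3) / 3       ≡⟨ +-distrib-/-∣ʳ 1 (n∣m*n (q + q + 1) {3}) ⟩
  1 / 3 + (q + q + 1) * 3 / 3     ≡⟨ m*n/n≡m (q + q + 1) 3 ⟩
  q + q + 1                       ∎
  where
  open ≡-Reasoning
  expand : ∀ q → 2 * (2 + q * 3) ≡ 1 + (q + q + 1) * 3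
  expand = solve-∀

module C₅-blowup (q : ℕ) where
  open Blowup C₅ C₅-refl C₅-sym (suc q)

  private
    representative : Fin 5 → Fin (suc q * 5)
    representative = combine {suc q} zero

    part-representative : ∀ a → part (representative a) ≡ a
    part-representative = part-combine zero

    representative-injective : ∀ {a b} → a ≢ b → representative a ≢ representative b
    representative-injective a≢b e =
      a≢b (trans (sym (part-representative _)) (trans (cong part e) (part-representative _)))

    v₀ u₀ w₀ : Fin (suc q * 5)
    v₀ = representative 0F
    u₀ = representative 1F
    w₀ = representative 2F

    v₀∼u₀ : adj blowup v₀ u₀ ≡ true
    v₀∼u₀ = adj-intro {v₀} {u₀} (cong₂ C₅ (part-representative 0F) (part-representative 1F))
      (representative-injective λ ())

    u₀∈S₁ : sphere blowup v₀ 1 u₀ ≡ true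
    u₀∈S₁ = trans (sphere₁ blowup v₀ u₀) v₀∼u₀

    twice-suc : ∀ q → suc q * 2 ≡ 2 + (q + q)
    twice-suc = solve-∀

    q+q≤ : ∀ {K L} → 2 ≤ K → suc q * K ≤ 2 + L → q + q ≤ L
    q+q≤ {K} {L} 2≤K h = +-cancelˡ-≤ 2 _ _
      (subst (_≤ 2 + L) (twice-suc q) (≤-trans (*-monoʳ-≤ (suc q) 2≤K) h))

  regular : Regular blowup (2 + q * 3)
  regular v = suc-injective (trans (degree-blowup v) (cong (suc q *_) (C₅-degree (part v))))

  connected : Connected blowup
  connected v w = 2 , withinDist₂-blowup C₅-diameter₂ v w

  notComplete : NotComplete blowup
  notComplete = v₀ , w₀ , representative-injective (λ ()) ,
    cong₂ (λ a b → C₅ a b ∧ not (does (v₀ ≟ w₀))) (part-representative 0F) (part-representative 2F)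

  minDegLink-lower : ∀ v r → 1 ≤ r → SphereNonempty blowup v r → q + q ≤ minDegLink blowup v r
  minDegLink-lower v 1 _ nonempty =
    minOver-glb (sphere blowup v 1) (linkDegree blowup v 1) (q + q) nonempty λ u u∈S₁ →
      let v∼u = trans (sym (sphere₁ blowup v u)) u∈S₁ in
      q+q≤ (C₅-common (part v) (part u) (∧-true⁻ˡ {a = C₅ (part v) (part u)} v∼u))
           (≤-reflexive (sym (link₁-blowup v u v∼u)))
  minDegLink-lower v 2 _ nonempty =
    minOver-glb (sphere blowup v 2) (linkDegree blowup v 2) (q + q) nonempty λ u u∈S₂ →
      let v≁u = not-true⁻ (trans (sym (sphere₂-blowup C₅-diameter₂ v u)) u∈S₂) in
      q+q≤ (C₅-private (part v) (part u) v≁u)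
           (≤-trans (≤-reflexive (sym (link₂-blowup C₅-diameter₂ v u v≁u))) (n≤1+n _))
  minDegLink-lower v (suc (suc (suc r))) _ (w , w∈S) =
    ⊥-elim (true≢false w∈S (sphere-beyond-2 C₅-diameter₂ r v w))

  minDegLink-v₀ : minDegLink blowup v₀ 1 ≡ q + q
  minDegLink-v₀ = ≤-antisym
    (≤-trans (minOver-≤ (sphere blowup v₀ 1) (linkDegree blowup v₀ 1) u₀ u₀∈S₁)
             (≤-reflexive linkDegree-u₀))
    (minDegLink-lower v₀ 1 (s≤s z≤n) (u₀ , u₀∈S₁))
    where
    linkDegree-u₀ : linkDegree blowup v₀ 1 u₀ ≡ q + q
    linkDegree-u₀ = +-cancelˡ-≡ 2 _ _ (begin
      2 + linkDegree blowup v₀ 1 u₀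
        ≡⟨ link₁-blowup v₀ u₀ v₀∼u₀ ⟩
      suc q * countFin (λ c → C₅ (part v₀) c ∧ C₅ (part u₀) c)
        ≡⟨ cong₂ (λ a b → suc q * countFin (λ c → C₅ a c ∧ C₅ b c))
                 (part-representative 0F) (part-representative 1F) ⟩
      suc q * 2
        ≡⟨ twice-suc q ⟩
      2 + (q + q) ∎)
      where open ≡-Reasoning

  attainsLinkBound : AttainsLinkBound (2 + q * 3)
  attainsLinkBound = suc q * 5 , blowup , connected , regular , notComplete ,
    (v₀ , 1 , s≤s z≤n , (u₀ , u₀∈S₁) ,
      trans (cong (_+ 1) minDegLink-v₀) (sym (2*[2+q*3]/3≡q+q+1 q))) ,
    λ v r 1≤r nonempty → subst (_≤ minDegLink blowup v r + 1) (sym (2*[2+q*3]/3≡q+q+1 q))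
      (+-monoˡ-≤ 1 (minDegLink-lower v r 1≤r nonempty))

extremal-graphs : ∀ (d : ℕ) → 1 ≤ d → d % 3 ≡ 2 → AttainsLinkBound d
extremal-graphs d _ d%3≡2 =
  subst AttainsLinkBound (sym d≡2+[d/3]*3) (C₅-blowup.attainsLinkBound (d / 3))
  where
  d≡2+[d/3]*3 : d ≡ 2 + d / 3 * 3
  d≡2+[d/3]*3 = trans (m≡m%n+[m/n]*n d 3) (cong (_+ d / 3 * 3) d%3≡2)

theorem1 :
    (∀ (d : ℕ) → 1 ≤ d → (n : ℕ) → (G : Graph n) →
      Connected G → Regular G d → NotComplete G →
      ∃[ v ] ∃[ r ] (1 ≤ r × SphereNonempty G v r × minDegLink G v r + 1 ≤ (2 * d) / 3))
    ×
    (∀ (d : ℕ) → 1 ≤ d → d % 3 ≡ 2 →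
      ∃[ n ] Σ (Graph n) λ G →
        Connected G × Regular G d × NotComplete G ×
        (∃[ v ] ∃[ r ] (1 ≤ r × SphereNonempty G v r × minDegLink G v r + 1 ≡ (2 * d) / 3)) ×
        (∀ v r → 1 ≤ r → SphereNonempty G v r → (2 * d) / 3 ≤ minDegLink G v r + 1))
theorem1 = minDegLink-bound , extremal-graphs
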